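{- Let $p\in[0,1]$. For every correlation clustering instance with optimal clustering $OPT$ of cost $C_{OPT}$, the expected number of queries made by \textsc{RandomQueryPivot}$(p)$ (described in the context), run with the oracle corresponding to $OPT$, is at most $\max(4p,1)\,C_{OPT}$.
   Context: Correlation clustering: the input is a complete graph $G=(V,E)$ in which every edge is labeled $+$ or $-$. A clustering is a partition of $V$; it makes a mistake on a $+$ edge whose endpoints are in different clusters and on a $-$ edge whose endpoints are in the same cluster. An optimal clustering $OPT$ minimizes the number of mistakes, denoted $C_{OPT}$. The oracle answers a query on $\{u,v\}$ by saying whether $OPT$ makes a mistake on it. A $(+,+,-)$ triangle is a set of three vertices two of whose edges are $+$ and one is $-$. \textsc{RandomQueryPivot}$(p)$ on remaining vertex set $V$: if $V=\emptyset$ return the empty clustering. Otherwise choose a pivot $u$ uniformly at random from $V$. All edges $\{u,x\}$ start unmarked. For each $(+,+,-)$ triangle $\{u,v,w\}$ with $v,w\in V$, independently with probability $p$ (else nothing): (1) if $\{u,v\},\{u,w\}$ are both $+$, query both and mark each iff $OPT$ errs on it; (2) if one is $+$ and the other $-$, query the $+$ edge and mark it if $OPT$ errs on it; if not, query the $-$ edge and mark it iff $OPT$ errs on it. Then $C$ consists of $u$ and every $x\in V\setminus\{u\}$ with ($\{u,x\}$ is $+$ and unmarked) or ($\{u,x\}$ is $-$ and marked). Return $\{C\}$ together with the recursive call on $V\setminus C$.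
   Formalization: The parameter p ranges over the rationals in [0,1]. -}

module Defs where

open import Data.Bool using (Bool; true; false; not; _∧_; _∨_; if_then_else_)
open import Data.Nat as ℕ using (ℕ; zero; suc)
open import Data.Fin using (Fin; toℕ)
open import Data.Fin.Properties using (_≟_)
open import Data.Product using (_×_; _,_; proj₁; proj₂)
open import Data.List using (List; []; _∷_; length; filter; map; concatMap; allFin)
open import Data.Bool.ListAction using (any)
open import Data.Integer using (+_)
open import Data.Rational using (ℚ; _+_; _*_; _-_; _/_; 0ℚ; 1ℚ)
open import Relation.Nullary.Decidable using (⌊_⌋)

-- Vertices are Fin n.  sign u v = true means the edge {u,v} is labelled +,
-- false means -.  (Symmetry of sign is a hypothesis of the theorem; the
-- diagonal values are never used.)
Signs : ℕ → Set
Signs n = Fin n → Fin n → Bool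

-- A clustering (partition of the vertex set), given by a cluster label per vertex.
Clustering : ℕ → Set
Clustering n = Fin n → Fin n

eqᵇ : ∀ {n} → Fin n → Fin n → Bool
eqᵇ u v = ⌊ u ≟ v ⌋

sameCluster : ∀ {n} → Clustering n → Fin n → Fin n → Bool
sameCluster cl u v = eqᵇ (cl u) (cl v)

mistake : ∀ {n} → Signs n → Clustering n → Fin n → Fin n → Bool
mistake s cl u v = if s u v then not (sameCluster cl u v) else sameCluster cl u v

countᵇ : ∀ {A : Set} → (A → Bool) → List A → ℕ
countᵇ f [] = 0
countᵇ f (x ∷ xs) = if f x then suc (countᵇ f xs) else countᵇ f xs

pairsOf : ∀ {n} → List (Fin n) → List (Fin n × Fin n)
pairsOf vs = concatMap (λ i → map (λ j → (i , j)) (filter (λ j → toℕ i ℕ.<? toℕ j) vs)) vs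

cost : ∀ {n} → Signs n → Clustering n → ℕ
cost {n} s cl = countᵇ (λ e → mistake s cl (proj₁ e) (proj₂ e)) (pairsOf (allFin n))

Optimal : ∀ {n} → Signs n → Clustering n → Set
Optimal {n} s opt = ∀ (cl : Clustering n) → cost s opt ℕ.≤ cost s cl

-- expect p k f = E[f(c₁,…,c_k)] where the cᵢ are independent, each true with probability p
expect : ℚ → ℕ → (List Bool → ℚ) → ℚ
expect p zero f = f []
expect p (suc k) f = p * expect p k (λ cs → f (true ∷ cs))
                   + (1ℚ - p) * expect p k (λ cs → f (false ∷ cs))

sumℚ : List ℚ → ℚ
sumℚ [] = 0ℚ
sumℚ (x ∷ xs) = x + sumℚ xs

ℕ→ℚ : ℕ → ℚ
ℕ→ℚ k = + k / 1

module Round {n : ℕ} (s : Signs n) (opt : Clustering n) (V : List (Fin n)) (u : Fin n) where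

  -- the oracle: does OPT err on {a,b}?
  err : Fin n → Fin n → Bool
  err = mistake s opt

  others : List (Fin n)
  others = filter (λ x → Relation.Nullary.Decidable.¬? (x ≟ u)) V

  plusCount : Fin n → Fin n → ℕ
  plusCount v w = countᵇ (λ b → b) (s u v ∷ s u w ∷ s v w ∷ [])

  -- the (+,+,-) triangles {u,v,w} with v,w ∈ V
  triangles : List (Fin n × Fin n)
  triangles = filter (λ e → plusCount (proj₁ e) (proj₂ e) ℕ.≟ 2) (pairsOf others)

  -- queries made on one triangle {u,v,w} (when its coin succeeds):
  -- a list of (x , mark?) meaning "edge {u,x} was queried, and marked iff mark? = true"
  triangleQueries : Fin n → Fin n → List (Fin n × Bool)
  triangleQueries v w with s u v | s u w
  ... | true  | true  = (v , err u v) ∷ (w , err u w) ∷ []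
  ... | true  | false = if err u v then (v , true) ∷ []
                        else (v , false) ∷ (w , err u w) ∷ []
  ... | false | true  = if err u w then (w , true) ∷ []
                        else (w , false) ∷ (v , err u v) ∷ []
  ... | false | false = []   -- impossible for a (+,+,-) triangle

  -- all query events, given one coin per triangle (coin true = probability-p event happened)
  events : List (Fin n × Fin n) → List Bool → List (Fin n × Bool)
  events [] _ = []
  events (_ ∷ _) [] = []
  events ((v , w) ∷ ts) (c ∷ cs) = (if c then triangleQueries v w else []) ++ events ts cs
    where open Data.List using (_++_)

  queried : List Bool → Fin n → Bool
  queried cs x = any (λ e → eqᵇ (proj₁ e) x) (events triangles cs)

  marked : List Bool → Fin n → Bool
  marked cs x = any (λ e → eqᵇ (proj₁ e) x ∧ proj₂ e) (events triangles cs)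

  -- number of queries = number of distinct edges {u,x} queried in this round
  numQueries : List Bool → ℕ
  numQueries cs = countᵇ (queried cs) others

  -- membership of x ∈ V \ {u} in the cluster C of u
  inC : List Bool → Fin n → Bool
  inC cs x = (s u x ∧ not (marked cs x)) ∨ (not (s u x) ∧ marked cs x)

  rest : List Bool → List (Fin n)
  rest cs = filter (λ x → Relation.Nullary.Decidable.¬? (Data.Bool._≟_ (inC cs x) true)) others

-- The first argument is fuel; each round removes at least the pivot, so fuel
-- = length V suffices (fuel 0 is only reached with V = []).

expectedQueries : ∀ {n} → Signs n → Clustering n → ℚ → ℕ → List (Fin n) → ℚ
expectedQueries s opt p zero V = 0ℚ
expectedQueries s opt p (suc f) [] = 0ℚ
expectedQueries s opt p (suc f) V@(_ ∷ _) =
  (+ 1 / length V) * sumℚ (map roundValue V)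
  where
  roundValue : _ → ℚ
  roundValue u = expect p (length triangles)
                   (λ cs → ℕ→ℚ (numQueries cs) + expectedQueries s opt p f (rest cs))
    where open Round s opt V u

-- A round with pivot u removes from the instance every mistake of OPT on an edge at u,
-- and every mistake on an edge vw such that uvw is a (+,+,-) triangle on whose other two
-- edges OPT is right (one of v, w then joins the cluster of u); these mistakes are
-- distinct and none of them survives into the remaining instance.  A query on which OPT
-- errs is paid for by a removed mistake at u.  A query on which OPT is right is made only
-- after a coin of probability p, and, summed over the three choices of the pivot inside a
-- (+,+,-) triangle, there are at most four such queries per removed mistake of that
-- triangle: by transitivity of OPT's clusters, OPT errs on exactly one of its edges or on
-- both + edges.  Averaging over the uniform pivot, each removed mistake is paid at most
-- max(4p, 1), and induction over the rounds gives the bound.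

module Submission where

open import Defs
open import Data.Nat using (ℕ)
open import Data.Fin using (Fin)
open import Data.List using (allFin)
open import Data.Rational using (ℚ; _≤_; _*_; _⊔_; 0ℚ; 1ℚ)
open import Relation.Binary.PropositionalEquality using (_≡_)

open import Data.Bool as Bool using (Bool; true; false; not; _∧_; _∨_; if_then_else_)
open import Data.Bool.Properties using (∧-comm; ∧-zeroʳ; ∨-zeroʳ)
open import Data.Empty using (⊥; ⊥-elim)
open import Data.Nat as ℕ using (zero; suc; z≤n; s≤s; _∸_)
  renaming (_+_ to _+ₙ_; _*_ to _*ₙ_; _≤_ to _≤ₙ_)
import Data.Nat.Properties as ℕ
open import Data.List using (List; []; _∷_; _++_; map; concatMap; filter; length)
open import Data.List.Membership.Propositional using (_∈_)
open import Data.List.Relation.Unary.Any using (here; there)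
open import Data.List.Relation.Unary.All using (All; []; _∷_)
import Data.List.Relation.Unary.All.Properties as All
import Data.List.Relation.Unary.Unique.Propositional.Properties as Unique
open import Data.List.Relation.Unary.Unique.Propositional using (Unique)
open import Data.List.Relation.Unary.AllPairs using ([]; _∷_)
open import Data.Bool.ListAction using (any)
open import Relation.Nullary using (Dec; does; yes; no)
open import Relation.Nullary.Decidable using (isYes≗does; dec-true; dec-false)
open import Data.Fin using (toℕ)
import Data.Fin.Properties as Fin
open import Data.Product using (_×_; _,_; proj₁; proj₂)
open import Function using (_∘_)
open import Data.Sum using (_⊎_; inj₁; inj₂)
open import Relation.Binary.Definitions using (tri<; tri≈; tri>)
open import Relation.Binary.PropositionalEquality
  using (_≢_; refl; sym; trans; cong; cong₂; subst; subst₂; module ≡-Reasoning)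
open import Data.Integer as ℤ using (+_)
import Data.Integer.Properties as ℤ
open import Data.Rational using (mkℚ; _+_; _-_; -_; _/_; *≤*; NonNegative; nonNegative)
import Data.Rational.Properties as ℚ
open import Data.Rational.Solver using (module +-*-Solver)
open import Data.Nat.Solver using () renaming (module +-*-Solver to ℕ-Solver)
open import Data.Nat.Coprimality as Coprimality using (1-coprimeTo)
open import Algebra.Properties.CommutativeSemigroup ℕ.+-commutativeSemigroup
  using () renaming (interchange to +-interchange)

-- Indicators and finite sums

𝟙 : Bool → ℕ
𝟙 true = 1
𝟙 false = 0

𝟙≤1 : ∀ b → 𝟙 b ≤ₙ 1
𝟙≤1 true = ℕ.≤-refl
𝟙≤1 false = z≤n

𝟙-∧ : ∀ a b → 𝟙 (a ∧ b) ≡ 𝟙 a *ₙ 𝟙 b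
𝟙-∧ true  b = sym (ℕ.*-identityˡ (𝟙 b))
𝟙-∧ false b = refl

𝟙-∧-* : ∀ a b m → 𝟙 (a ∧ b) *ₙ m ≡ 𝟙 a *ₙ (𝟙 b *ₙ m)
𝟙-∧-* true  b m = sym (ℕ.*-identityˡ _)
𝟙-∧-* false b m = refl

𝟙-*-≤ : ∀ b m {x y} → (b ≡ true → x ≤ₙ m *ₙ y) → 𝟙 b *ₙ x ≤ₙ m *ₙ (𝟙 b *ₙ y)
𝟙-*-≤ true  m {x} {y} le rewrite ℕ.*-identityˡ x | ℕ.*-identityˡ y = le refl
𝟙-*-≤ false m le = z≤n

∧-trueˡ : ∀ x {y} → x ∧ y ≡ true → x ≡ true
∧-trueˡ true _ = refl

not-true : ∀ {x} → not x ≡ true → x ≡ false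
not-true {false} _ = refl

𝟙-exclusive : ∀ x y → (x ≡ true → y ≡ true → ⊥) → 𝟙 x +ₙ 𝟙 y ≤ₙ 1
𝟙-exclusive true  true  excl = ⊥-elim (excl refl refl)
𝟙-exclusive true  false _    = ℕ.≤-refl
𝟙-exclusive false y     _    = 𝟙≤1 y

∧-trueʳ : ∀ x {y} → x ∧ y ≡ true → y ≡ true
∧-trueʳ true y≡true = y≡true

∑ : {A : Set} → List A → (A → ℕ) → ℕ
∑ [] f = 0
∑ (x ∷ xs) f = f x +ₙ ∑ xs f

syntax ∑ xs (λ x → e) = ∑[ x ∈ xs ] e

module _ {A : Set} where

  ∑-cong : ∀ xs {f g : A → ℕ} → (∀ x → f x ≡ g x) → ∑ xs f ≡ ∑ xs g
  ∑-cong [] e = refl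
  ∑-cong (x ∷ xs) e = cong₂ _+ₙ_ (e x) (∑-cong xs e)

  ∑-cong-∈ : ∀ xs {f g : A → ℕ} → (∀ x → x ∈ xs → f x ≡ g x) → ∑ xs f ≡ ∑ xs g
  ∑-cong-∈ [] e = refl
  ∑-cong-∈ (x ∷ xs) e = cong₂ _+ₙ_ (e x (here refl)) (∑-cong-∈ xs (λ y y∈ → e y (there y∈)))

  ∑-mono : ∀ xs {f g : A → ℕ} → (∀ x → f x ≤ₙ g x) → ∑ xs f ≤ₙ ∑ xs g
  ∑-mono [] le = z≤n
  ∑-mono (x ∷ xs) le = ℕ.+-mono-≤ (le x) (∑-mono xs le)

  ∑-+ : ∀ xs (f g : A → ℕ) → ∑[ x ∈ xs ] (f x +ₙ g x) ≡ ∑ xs f +ₙ ∑ xs g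
  ∑-+ [] f g = refl
  ∑-+ (x ∷ xs) f g =
    trans (cong (f x +ₙ g x +ₙ_) (∑-+ xs f g)) (+-interchange (f x) (g x) (∑ xs f) (∑ xs g))

  ∑-*ˡ : ∀ xs k (f : A → ℕ) → ∑[ x ∈ xs ] (k *ₙ f x) ≡ k *ₙ ∑ xs f
  ∑-*ˡ [] k f = sym (ℕ.*-zeroʳ k)
  ∑-*ˡ (x ∷ xs) k f = trans (cong (k *ₙ f x +ₙ_) (∑-*ˡ xs k f)) (sym (ℕ.*-distribˡ-+ k (f x) _))

  ∑-const : ∀ (xs : List A) k → ∑[ x ∈ xs ] k ≡ length xs *ₙ k
  ∑-const [] k = refl
  ∑-const (x ∷ xs) k = cong (k +ₙ_) (∑-const xs k)

  ∑-++ : ∀ xs ys (f : A → ℕ) → ∑ (xs ++ ys) f ≡ ∑ xs f +ₙ ∑ ys f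
  ∑-++ [] ys f = refl
  ∑-++ (x ∷ xs) ys f = trans (cong (f x +ₙ_) (∑-++ xs ys f)) (sym (ℕ.+-assoc (f x) _ _))

  ∑-filter : ∀ {P : A → Set} (P? : ∀ x → Dec (P x)) xs (f : A → ℕ) →
             ∑ (filter P? xs) f ≡ ∑[ x ∈ xs ] (𝟙 (does (P? x)) *ₙ f x)
  ∑-filter P? [] f = refl
  ∑-filter P? (x ∷ xs) f with does (P? x)
  ... | true  = cong₂ _+ₙ_ (sym (ℕ.+-identityʳ (f x))) (∑-filter P? xs f)
  ... | false = ∑-filter P? xs f

  countᵇ≡∑ : ∀ (f : A → Bool) xs → countᵇ f xs ≡ ∑[ x ∈ xs ] 𝟙 (f x)
  countᵇ≡∑ f [] = refl
  countᵇ≡∑ f (x ∷ xs) with f x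
  ... | true  = cong suc (countᵇ≡∑ f xs)
  ... | false = countᵇ≡∑ f xs

  ∑-cong-All : ∀ {P : A → Set} {xs} {f g : A → ℕ} → All P xs → (∀ x → P x → f x ≡ g x) →
               ∑ xs f ≡ ∑ xs g
  ∑-cong-All [] e = refl
  ∑-cong-All {xs = x ∷ _} (px ∷ pxs) e = cong₂ _+ₙ_ (e x px) (∑-cong-All pxs e)

  𝟙-any≤∑ : ∀ (f : A → Bool) xs → 𝟙 (any f xs) ≤ₙ ∑[ x ∈ xs ] 𝟙 (f x)
  𝟙-any≤∑ f [] = z≤n
  𝟙-any≤∑ f (x ∷ xs) with f x
  ... | true  = s≤s z≤n
  ... | false = 𝟙-any≤∑ f xs

module _ {A B : Set} where

  ∑-map : ∀ xs (h : A → B) (f : B → ℕ) → ∑ (map h xs) f ≡ ∑[ x ∈ xs ] f (h x)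
  ∑-map [] h f = refl
  ∑-map (x ∷ xs) h f = cong (f (h x) +ₙ_) (∑-map xs h f)

  ∑-concatMap : ∀ xs (h : A → List B) (f : B → ℕ) →
                ∑ (concatMap h xs) f ≡ ∑[ x ∈ xs ] ∑ (h x) f
  ∑-concatMap [] h f = refl
  ∑-concatMap (x ∷ xs) h f =
    trans (∑-++ (h x) (concatMap h xs) f) (cong (∑ (h x) f +ₙ_) (∑-concatMap xs h f))

  ∑-comm : ∀ xs ys (f : A → B → ℕ) → ∑[ x ∈ xs ] ∑[ y ∈ ys ] f x y ≡ ∑[ y ∈ ys ] ∑[ x ∈ xs ] f x y
  ∑-comm [] ys f = sym (trans (∑-const ys 0) (ℕ.*-zeroʳ (length ys)))
  ∑-comm (x ∷ xs) ys f =
    trans (cong (∑ ys (f x) +ₙ_) (∑-comm xs ys f)) (sym (∑-+ ys (f x) (λ y → ∑[ x ∈ xs ] f x y)))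

∑² : {A : Set} → List A → (A → A → ℕ) → ℕ
∑² xs f = ∑[ a ∈ xs ] ∑[ b ∈ xs ] f a b

∑²-+ : {A : Set} (xs : List A) (f g : A → A → ℕ) →
       ∑² xs (λ a b → f a b +ₙ g a b) ≡ ∑² xs f +ₙ ∑² xs g
∑²-+ xs f g = trans (∑-cong xs (λ a → ∑-+ xs (f a) (g a))) (∑-+ xs _ _)

-- Rational arithmetic and expectation over independent coins

ℕ→ℚ≡mkℚ : ∀ k → ℕ→ℚ k ≡ mkℚ (+ k) 0 (Coprimality.sym (1-coprimeTo k))
ℕ→ℚ≡mkℚ k = ℚ.normalize-coprime _

ℕ→ℚ-+ : ∀ a b → ℕ→ℚ (a +ₙ b) ≡ ℕ→ℚ a + ℕ→ℚ b
ℕ→ℚ-+ a b rewrite ℕ→ℚ≡mkℚ a | ℕ→ℚ≡mkℚ b =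
  cong (_/ 1) (cong₂ ℤ._+_ (sym (ℤ.*-identityʳ (+ a))) (sym (ℤ.*-identityʳ (+ b))))

ℕ→ℚ-* : ∀ a b → ℕ→ℚ (a *ₙ b) ≡ ℕ→ℚ a * ℕ→ℚ b
ℕ→ℚ-* a b rewrite ℕ→ℚ≡mkℚ a | ℕ→ℚ≡mkℚ b = cong (_/ 1) (ℤ.pos-* a b)

ℕ→ℚ-mono : ∀ {a b} → a ≤ₙ b → ℕ→ℚ a ≤ ℕ→ℚ b
ℕ→ℚ-mono {a} {b} a≤b rewrite ℕ→ℚ≡mkℚ a | ℕ→ℚ≡mkℚ b =
  *≤* (ℤ.*-monoʳ-≤-nonNeg (+ 1) (ℤ.+≤+ a≤b))

ℕ→ℚ-nonNeg : ∀ a → 0ℚ ≤ ℕ→ℚ a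
ℕ→ℚ-nonNeg a = ℕ→ℚ-mono {0} {a} z≤n

1/[1+k]*[1+k]≡1 : ∀ k → (+ 1 / suc k) * ℕ→ℚ (suc k) ≡ 1ℚ
1/[1+k]*[1+k]≡1 k rewrite ℕ→ℚ≡mkℚ (suc k) | ℚ.normalize-coprime (1-coprimeTo (suc k)) =
  ℚ.*-inverseˡ (mkℚ (+ suc k) 0 (Coprimality.sym (1-coprimeTo (suc k))))

selectedTotal : {A : Set} → (A → ℕ) → List A → List Bool → ℕ
selectedTotal a [] _ = 0
selectedTotal a (_ ∷ _) [] = 0
selectedTotal a (t ∷ ts) (c ∷ cs) = (if c then a t else 0) +ₙ selectedTotal a ts cs

module Expectation (p : ℚ) where

  open +-*-Solver

  expect-cong : ∀ k {f g : List Bool → ℚ} → (∀ cs → f cs ≡ g cs) → expect p k f ≡ expect p k g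
  expect-cong zero e = e []
  expect-cong (suc k) e =
    cong₂ (λ x y → p * x + (1ℚ - p) * y)
          (expect-cong k (λ cs → e (true ∷ cs))) (expect-cong k (λ cs → e (false ∷ cs)))

  expect-const : ∀ k a → expect p k (λ _ → a) ≡ a
  expect-const zero a = refl
  expect-const (suc k) a rewrite expect-const k a =
    solve 2 (λ p a → p :* a :+ (con 1ℚ :- p) :* a := a) refl p a

  expect-+ : ∀ k (f g : List Bool → ℚ) → expect p k (λ cs → f cs + g cs) ≡ expect p k f + expect p k g
  expect-+ zero f g = refl
  expect-+ (suc k) f g
    rewrite expect-+ k (λ cs → f (true ∷ cs)) (λ cs → g (true ∷ cs))
          | expect-+ k (λ cs → f (false ∷ cs)) (λ cs → g (false ∷ cs)) =
    solve 5 (λ p a b c d → p :* (a :+ b) :+ (con 1ℚ :- p) :* (c :+ d)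
                        := (p :* a :+ (con 1ℚ :- p) :* c) :+ (p :* b :+ (con 1ℚ :- p) :* d))
          refl p _ _ _ _

  expect-selectedTotal : {A : Set} (a : A → ℕ) (ts : List A) →
    expect p (length ts) (λ cs → ℕ→ℚ (selectedTotal a ts cs)) ≡ p * ℕ→ℚ (∑ ts a)
  expect-selectedTotal a [] = sym (ℚ.*-zeroʳ p)
  expect-selectedTotal a (t ∷ ts) = begin
    p * expect p k (λ cs → ℕ→ℚ (a t +ₙ rest cs)) + (1ℚ - p) * expect p k (λ cs → ℕ→ℚ (rest cs))
      ≡⟨ cong (λ z → p * z + (1ℚ - p) * E) (expect-cong k (λ cs → ℕ→ℚ-+ (a t) (rest cs))) ⟩
    p * expect p k (λ cs → ℕ→ℚ (a t) + ℕ→ℚ (rest cs)) + (1ℚ - p) * expect p k (λ cs → ℕ→ℚ (rest cs))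
      ≡⟨ cong (λ z → p * z + (1ℚ - p) * E) (expect-+ k (λ _ → ℕ→ℚ (a t)) (λ cs → ℕ→ℚ (rest cs))) ⟩
    p * (expect p k (λ _ → ℕ→ℚ (a t)) + E) + (1ℚ - p) * E
      ≡⟨ cong₂ (λ x y → p * (x + y) + (1ℚ - p) * y) (expect-const k (ℕ→ℚ (a t))) (expect-selectedTotal a ts) ⟩
    p * (ℕ→ℚ (a t) + p * ℕ→ℚ (∑ ts a)) + (1ℚ - p) * (p * ℕ→ℚ (∑ ts a))
      ≡⟨ solve 3 (λ p x y → p :* (x :+ p :* y) :+ (con 1ℚ :- p) :* (p :* y) := p :* (x :+ y))
               refl p (ℕ→ℚ (a t)) (ℕ→ℚ (∑ ts a)) ⟩
    p * (ℕ→ℚ (a t) + ℕ→ℚ (∑ ts a))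
      ≡⟨ cong (p *_) (ℕ→ℚ-+ (a t) (∑ ts a)) ⟨
    p * ℕ→ℚ (∑ (t ∷ ts) a) ∎
    where
    open ≡-Reasoning
    k : ℕ
    k = length ts
    rest : List Bool → ℕ
    rest = selectedTotal a ts
    E : ℚ
    E = expect p k (λ cs → ℕ→ℚ (rest cs))

  module _ (0≤p : 0ℚ ≤ p) (p≤1 : p ≤ 1ℚ) where

    private instance
      p-nonNeg : NonNegative p
      p-nonNeg = nonNegative 0≤p
      1-p-nonNeg : NonNegative (1ℚ - p)
      1-p-nonNeg = nonNegative (subst (_≤ 1ℚ - p) (ℚ.+-inverseʳ p) (ℚ.+-monoˡ-≤ (- p) p≤1))

    expect-mono : ∀ k {f g : List Bool → ℚ} → (∀ cs → f cs ≤ g cs) → expect p k f ≤ expect p k g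
    expect-mono zero le = le []
    expect-mono (suc k) le =
      ℚ.+-mono-≤ (ℚ.*-monoˡ-≤-nonNeg p (expect-mono k (λ cs → le (true ∷ cs))))
                 (ℚ.*-monoˡ-≤-nonNeg (1ℚ - p) (expect-mono k (λ cs → le (false ∷ cs))))

sumℚ-mono-∈ : {A : Set} (xs : List A) {f g : A → ℚ} → (∀ x → x ∈ xs → f x ≤ g x) →
              sumℚ (map f xs) ≤ sumℚ (map g xs)
sumℚ-mono-∈ [] le = ℚ.≤-refl
sumℚ-mono-∈ (x ∷ xs) le = ℚ.+-mono-≤ (le x (here refl)) (sumℚ-mono-∈ xs (λ y y∈ → le y (there y∈)))

sumℚ-linear : {A : Set} (xs : List A) (p c : ℚ) (f g h : A → ℕ) →
  sumℚ (map (λ x → ℕ→ℚ (f x) + p * ℕ→ℚ (g x) + c * ℕ→ℚ (h x)) xs)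
    ≡ ℕ→ℚ (∑ xs f) + p * ℕ→ℚ (∑ xs g) + c * ℕ→ℚ (∑ xs h)
sumℚ-linear [] p c f g h = solve 2 (λ p c → con 0ℚ := con 0ℚ :+ p :* con 0ℚ :+ c :* con 0ℚ) refl p c
  where open +-*-Solver
sumℚ-linear (x ∷ xs) p c f g h
  rewrite sumℚ-linear xs p c f g h | ℕ→ℚ-+ (f x) (∑ xs f) | ℕ→ℚ-+ (g x) (∑ xs g) | ℕ→ℚ-+ (h x) (∑ xs h) =
  solve 8 (λ p c a b d a′ b′ d′ → a :+ p :* b :+ c :* d :+ (a′ :+ p :* b′ :+ c :* d′)
                               := a :+ a′ :+ p :* (b :+ b′) :+ c :* (d :+ d′))
        refl p c (ℕ→ℚ (f x)) (ℕ→ℚ (g x)) (ℕ→ℚ (h x)) (ℕ→ℚ (∑ xs f)) (ℕ→ℚ (∑ xs g)) (ℕ→ℚ (∑ xs h))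
  where open +-*-Solver

module Charging (p : ℚ) (0≤p : 0ℚ ≤ p) where

  c : ℚ
  c = (ℕ→ℚ 4 * p) ⊔ 1ℚ

  private instance
    p-nonNeg : NonNegative p
    p-nonNeg = nonNegative 0≤p
    c-nonNeg : NonNegative c
    c-nonNeg = nonNegative (ℚ.≤-trans (ℕ→ℚ-nonNeg 1) (ℚ.p≤q⊔p (ℕ→ℚ 4 * p) 1ℚ))

  0≤c*ℕ→ℚ : ∀ k → 0ℚ ≤ c * ℕ→ℚ k
  0≤c*ℕ→ℚ k = subst (_≤ c * ℕ→ℚ k) (ℚ.*-zeroʳ c) (ℚ.*-monoˡ-≤-nonNeg c (ℕ→ℚ-nonNeg k))

  c*-mono : ∀ {a b} → a ≤ₙ b → c * ℕ→ℚ a ≤ c * ℕ→ℚ b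
  c*-mono a≤b = ℚ.*-monoˡ-≤-nonNeg c (ℕ→ℚ-mono a≤b)

  average≤ : ∀ m i w d k {t} → w ≤ₙ 4 *ₙ t → i +ₙ t +ₙ d ≡ suc m *ₙ k →
             (+ 1 / suc m) * (ℕ→ℚ i + p * ℕ→ℚ w + c * ℕ→ℚ d) ≤ c * ℕ→ℚ k
  average≤ m i w d k {t} w≤4t total = begin
    x * (ℕ→ℚ i + p * ℕ→ℚ w + c * ℕ→ℚ d)
      ≤⟨ ℚ.*-monoˡ-≤-nonNeg x (ℚ.+-mono-≤ (ℚ.+-mono-≤ i≤ci w≤ct) ℚ.≤-refl) ⟩
    x * (c * ℕ→ℚ i + c * ℕ→ℚ t + c * ℕ→ℚ d)
      ≡⟨ cong (x *_) (solve 4 (λ c a b d → c :* a :+ c :* b :+ c :* d := c :* (a :+ b :+ d))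
                             refl c (ℕ→ℚ i) (ℕ→ℚ t) (ℕ→ℚ d)) ⟩
    x * (c * (ℕ→ℚ i + ℕ→ℚ t + ℕ→ℚ d))
      ≡⟨ cong (λ z → x * (c * z))
              (trans (sym (trans (ℕ→ℚ-+ (i +ₙ t) d) (cong (_+ ℕ→ℚ d) (ℕ→ℚ-+ i t))))
                     (trans (cong ℕ→ℚ total) (ℕ→ℚ-* (suc m) k))) ⟩
    x * (c * (ℕ→ℚ (suc m) * ℕ→ℚ k))
      ≡⟨ solve 4 (λ x c y z → x :* (c :* (y :* z)) := (x :* y) :* (c :* z))
               refl x c (ℕ→ℚ (suc m)) (ℕ→ℚ k) ⟩
    (x * ℕ→ℚ (suc m)) * (c * ℕ→ℚ k)
      ≡⟨ trans (cong (_* (c * ℕ→ℚ k)) (1/[1+k]*[1+k]≡1 m)) (ℚ.*-identityˡ _) ⟩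
    c * ℕ→ℚ k ∎
    where
    open ℚ.≤-Reasoning
    open +-*-Solver
    x : ℚ
    x = + 1 / suc m
    instance
      x-nonNeg : NonNegative x
      x-nonNeg = ℚ.normalize-nonNeg 1 (suc m)
    i≤ci : ℕ→ℚ i ≤ c * ℕ→ℚ i
    i≤ci = subst (_≤ c * ℕ→ℚ i) (ℚ.*-identityˡ (ℕ→ℚ i))
                 (ℚ.*-monoʳ-≤-nonNeg (ℕ→ℚ i) {{nonNegative (ℕ→ℚ-nonNeg i)}} (ℚ.p≤q⊔p (ℕ→ℚ 4 * p) 1ℚ))
    w≤ct : p * ℕ→ℚ w ≤ c * ℕ→ℚ t
    w≤ct = begin
      p * ℕ→ℚ w          ≤⟨ ℚ.*-monoˡ-≤-nonNeg p (ℕ→ℚ-mono w≤4t) ⟩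
      p * ℕ→ℚ (4 *ₙ t)   ≡⟨ trans (cong (p *_) (ℕ→ℚ-* 4 t))
                                  (solve 3 (λ p a b → p :* (a :* b) := a :* p :* b) refl p (ℕ→ℚ 4) (ℕ→ℚ t)) ⟩
      ℕ→ℚ 4 * p * ℕ→ℚ t  ≤⟨ ℚ.*-monoʳ-≤-nonNeg (ℕ→ℚ t) {{nonNegative (ℕ→ℚ-nonNeg t)}}
                                                (ℚ.p≤p⊔q (ℕ→ℚ 4 * p) 1ℚ) ⟩
      c * ℕ→ℚ t          ∎

module _ {n : ℕ} where

  eqᵇ⇒≡ : ∀ {x y : Fin n} → eqᵇ x y ≡ true → x ≡ y
  eqᵇ⇒≡ {x} {y} h with x Fin.≟ y
  ... | yes x≡y = x≡y

  eqᵇ-false : ∀ {x y : Fin n} → x ≢ y → eqᵇ x y ≡ false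
  eqᵇ-false {x} {y} x≢y = trans (isYes≗does (x Fin.≟ y)) (dec-false (x Fin.≟ y) x≢y)

  eqᵇ-refl : ∀ (x : Fin n) → eqᵇ x x ≡ true
  eqᵇ-refl x = trans (isYes≗does (x Fin.≟ x)) (dec-true (x Fin.≟ x) refl)

  eqᵇ-sym : ∀ (x y : Fin n) → eqᵇ x y ≡ eqᵇ y x
  eqᵇ-sym x y with x Fin.≟ y
  ... | yes refl = sym (eqᵇ-refl x)
  ... | no x≢y = sym (eqᵇ-false (x≢y ∘ sym))

  eqᵇ-trans : ∀ {x y z : Fin n} → eqᵇ x y ≡ true → eqᵇ y z ≡ true → eqᵇ x z ≡ true
  eqᵇ-trans {x} x≡y y≡z rewrite eqᵇ⇒≡ x≡y | eqᵇ⇒≡ y≡z = eqᵇ-refl _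

  lt : Fin n → Fin n → Bool
  lt i j = does (toℕ i ℕ.<? toℕ j)

  lt-irrefl : ∀ (i : Fin n) → lt i i ≡ false
  lt-irrefl i = dec-false (toℕ i ℕ.<? toℕ i) (ℕ.<-irrefl refl)

  𝟙-lt-pair : ∀ (i j : Fin n) m → 𝟙 (lt i j) *ₙ m +ₙ 𝟙 (lt j i) *ₙ m ≡ 𝟙 (not (eqᵇ j i)) *ₙ m
  𝟙-lt-pair i j m with ℕ.<-cmp (toℕ i) (toℕ j)
  ... | tri< i<j _ _
    rewrite dec-true (toℕ i ℕ.<? toℕ j) i<j | dec-false (toℕ j ℕ.<? toℕ i) (ℕ.<⇒≯ i<j)
          | eqᵇ-false {j} {i} (λ j≡i → ℕ.<-irrefl (cong toℕ (sym j≡i)) i<j) = ℕ.+-identityʳ _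
  ... | tri> _ _ i>j
    rewrite dec-false (toℕ i ℕ.<? toℕ j) (ℕ.<⇒≯ i>j) | dec-true (toℕ j ℕ.<? toℕ i) i>j
          | eqᵇ-false {j} {i} (λ j≡i → ℕ.<-irrefl (cong toℕ j≡i) i>j) = refl
  ... | tri≈ _ i≡j _ rewrite Fin.toℕ-injective i≡j | lt-irrefl j | eqᵇ-refl j = refl

  ∑-pairsOf : ∀ (xs : List (Fin n)) (g : Fin n × Fin n → ℕ) →
              ∑ (pairsOf xs) g ≡ ∑² xs (λ i j → 𝟙 (lt i j) *ₙ g (i , j))
  ∑-pairsOf xs g = trans (∑-concatMap xs _ g) (∑-cong xs (λ i →
    trans (∑-map (filter (λ j → toℕ i ℕ.<? toℕ j) xs) (i ,_) g)
          (∑-filter (λ j → toℕ i ℕ.<? toℕ j) xs (λ j → g (i , j)))))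

  ∑-indicator-∈ : ∀ {xs : List (Fin n)} {y} → y ∈ xs → (h : Fin n → ℕ) →
                  h y ≤ₙ ∑[ x ∈ xs ] (𝟙 (eqᵇ x y) *ₙ h x)
  ∑-indicator-∈ {x ∷ xs} (here refl) h rewrite eqᵇ-refl x =
    ℕ.≤-trans (ℕ.≤-reflexive (sym (ℕ.*-identityˡ (h x)))) (ℕ.m≤m+n _ _)
  ∑-indicator-∈ (there y∈) h = ℕ.≤-trans (∑-indicator-∈ y∈ h) (ℕ.m≤n+m _ _)

  ∑-indicator-unique : ∀ {xs : List (Fin n)} → Unique xs → ∀ y (h : Fin n → ℕ) →
                       ∑[ x ∈ xs ] (𝟙 (eqᵇ y x) *ₙ h x) ≤ₙ h y
  ∑-indicator-unique [] y h = z≤n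
  ∑-indicator-unique {x ∷ xs} (x∉xs ∷ uxs) y h with y Fin.≟ x
  ... | no _ = ∑-indicator-unique uxs y h
  ... | yes refl =
    ℕ.≤-reflexive (trans (cong (_ +ₙ_) (∑-zero x∉xs)) (trans (ℕ.+-identityʳ _) (ℕ.*-identityˡ _)))
    where
    ∑-zero : ∀ {zs} → All (x ≢_) zs → ∑[ z ∈ zs ] (𝟙 (eqᵇ x z) *ₙ h z) ≡ 0
    ∑-zero [] = refl
    ∑-zero (x≢z ∷ x∉zs) rewrite eqᵇ-false x≢z = ∑-zero x∉zs

-- (+,+,-) triangles

-- Agrees definitionally with the test plusCount v w ≟ 2 selecting the triangles of a round.
isPlusPlusMinus : Bool → Bool → Bool → Bool
isPlusPlusMinus x y z = does (countᵇ (λ b → b) (x ∷ y ∷ z ∷ []) ℕ.≟ 2)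

isPlusPlusMinus-cases : ∀ x y z → isPlusPlusMinus x y z ≡ true →
  (x ≡ true × y ≡ true × z ≡ false) ⊎ (x ≡ true × y ≡ false × z ≡ true) ⊎ (x ≡ false × y ≡ true × z ≡ true)
isPlusPlusMinus-cases true  true  false _ = inj₁ (refl , refl , refl)
isPlusPlusMinus-cases true  false true  _ = inj₂ (inj₁ (refl , refl , refl))
isPlusPlusMinus-cases false true  true  _ = inj₂ (inj₂ (refl , refl , refl))
isPlusPlusMinus-cases true  true  true  ()
isPlusPlusMinus-cases true  false false ()
isPlusPlusMinus-cases false true  false ()
isPlusPlusMinus-cases false false true  ()
isPlusPlusMinus-cases false false false ()

isPlusPlusMinus-swap₂₃ : ∀ x y z → isPlusPlusMinus x y z ≡ isPlusPlusMinus x z y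
isPlusPlusMinus-swap₂₃ x true  true  = refl
isPlusPlusMinus-swap₂₃ x true  false = refl
isPlusPlusMinus-swap₂₃ x false true  = refl
isPlusPlusMinus-swap₂₃ x false false = refl

isPlusPlusMinus-rotate : ∀ x y z → isPlusPlusMinus y z x ≡ isPlusPlusMinus x y z
isPlusPlusMinus-rotate true  true  true  = refl
isPlusPlusMinus-rotate true  true  false = refl
isPlusPlusMinus-rotate true  false true  = refl
isPlusPlusMinus-rotate true  false false = refl
isPlusPlusMinus-rotate false true  true  = refl
isPlusPlusMinus-rotate false true  false = refl
isPlusPlusMinus-rotate false false true  = refl
isPlusPlusMinus-rotate false false false = refl

isPlusPlusMinus-swap₁₂ : ∀ x y z → isPlusPlusMinus y x z ≡ isPlusPlusMinus x y z
isPlusPlusMinus-swap₁₂ x y z = trans (isPlusPlusMinus-swap₂₃ y x z) (isPlusPlusMinus-rotate x y z)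

isPlusPlusMinus⇒∨ : ∀ x y z → isPlusPlusMinus x y z ≡ true → x ∨ y ≡ true
isPlusPlusMinus⇒∨ x y z ppm with isPlusPlusMinus-cases x y z ppm
... | inj₁ (refl , _ , _)        = refl
... | inj₂ (inj₁ (refl , _ , _)) = refl
... | inj₂ (inj₂ (_ , refl , _)) = ∨-zeroʳ x

-- Number of queries on which OPT is right, for a pivot u and a (+,+,-) triangle uvw, given the
-- signs of uv and uw and whether OPT errs on them; a + edge is queried before a - edge.
correctQueries : Bool → Bool → Bool → Bool → ℕ
correctQueries true  true  ev    ew    = 𝟙 (not ev) +ₙ 𝟙 (not ew)
correctQueries true  false true  _     = 0
correctQueries true  false false ew    = suc (𝟙 (not ew))
correctQueries false true  _     true  = 0
correctQueries false true  ev    false = suc (𝟙 (not ev))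
correctQueries false false _     _     = 0

-- The triangle abc has - edge bc, and qxy says whether OPT puts x and y together (the
-- hypotheses are transitivity).  The left side counts the correct queries with pivot a, b and
-- c, the right side the mistakes these pivots destroy.  By transitivity OPT errs on exactly one
-- edge, or on both + edges, and then no query is correct.
apexBound : ∀ qab qac qbc →
  (qab ≡ true → qac ≡ true → qbc ≡ true) → (qab ≡ true → qbc ≡ true → qac ≡ true) →
  (qac ≡ true → qbc ≡ true → qab ≡ true) →
  correctQueries true true (not qab) (not qac) +ₙ correctQueries true false (not qab) qbc
    +ₙ correctQueries true false (not qac) qbc
  ≤ₙ 4 *ₙ (𝟙 (qbc ∧ not (not qab) ∧ not (not qac)) +ₙ 𝟙 (not qac ∧ not (not qab) ∧ not qbc)
           +ₙ 𝟙 (not qab ∧ not (not qac) ∧ not qbc))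
apexBound true  true  true  _ _ _ = ℕ.≤-refl
apexBound true  true  false t _ _ with t refl refl
... | ()
apexBound true  false true  _ t _ with t refl refl
... | ()
apexBound true  false false _ _ _ = ℕ.n≤1+n 3
apexBound false true  true  _ _ t with t refl refl
... | ()
apexBound false true  false _ _ _ = ℕ.n≤1+n 3
apexBound false false true  _ _ _ = z≤n
apexBound false false false _ _ _ = z≤n

pivotSum : {A : Set} → (A → A → A → ℕ) → A → A → A → ℕ
pivotSum h a b c = h a b c +ₙ h b a c +ₙ h c a b

correctQueries-comm : ∀ x y ev ew → correctQueries x y ev ew ≡ correctQueries y x ew ev
correctQueries-comm true  true  ev    ew    = ℕ.+-comm (𝟙 (not ev)) (𝟙 (not ew))
correctQueries-comm true  false true  _     = refl
correctQueries-comm true  false false _     = refl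
correctQueries-comm false true  _     true  = refl
correctQueries-comm false true  _     false = refl
correctQueries-comm false false _     _     = refl

module _ {A : Set} {h : A → A → A → ℕ} (h-sym : ∀ u v w → h u v w ≡ h u w v) where

  pivotSum-swap : ∀ a b c → pivotSum h b a c ≡ pivotSum h a b c
  pivotSum-swap a b c =
    cong₂ _+ₙ_ (ℕ.+-comm (h b a c) (h a b c)) (h-sym c b a)

  pivotSum-rotate : ∀ a b c → pivotSum h c a b ≡ pivotSum h a b c
  pivotSum-rotate a b c = begin
    h c a b +ₙ h a c b +ₙ h b c a  ≡⟨ cong₂ (λ x y → h c a b +ₙ x +ₙ y) (h-sym a c b) (h-sym b c a) ⟩
    h c a b +ₙ h a b c +ₙ h b a c  ≡⟨ ℕ.+-assoc (h c a b) _ _ ⟩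
    h c a b +ₙ (h a b c +ₙ h b a c) ≡⟨ ℕ.+-comm (h c a b) _ ⟩
    h a b c +ₙ h b a c +ₙ h c a b  ∎
    where open ≡-Reasoning

symmetrise : {A : Set} → (A → A → A → ℕ) → A → A → A → ℕ
symmetrise F a b c = (F a b c +ₙ F a c b) +ₙ (F b a c +ₙ F b c a) +ₙ (F c a b +ₙ F c b a)

module _ {A : Set} (xs : List A) where

  ∑³ : (A → A → A → ℕ) → ℕ
  ∑³ F = ∑[ a ∈ xs ] ∑[ b ∈ xs ] ∑[ c ∈ xs ] F a b c

  ∑³-+ : ∀ F G → ∑³ (λ a b c → F a b c +ₙ G a b c) ≡ ∑³ F +ₙ ∑³ G
  ∑³-+ F G = trans (∑-cong xs (λ a → trans (∑-cong xs (λ b → ∑-+ xs (F a b) (G a b))) (∑-+ xs _ _)))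
                   (∑-+ xs _ _)

  ∑³-mono : ∀ {F G} → (∀ a b c → F a b c ≤ₙ G a b c) → ∑³ F ≤ₙ ∑³ G
  ∑³-mono le = ∑-mono xs (λ a → ∑-mono xs (λ b → ∑-mono xs (le a b)))

  ∑³-*ˡ : ∀ k F → ∑³ (λ a b c → k *ₙ F a b c) ≡ k *ₙ ∑³ F
  ∑³-*ˡ k F = trans (∑-cong xs (λ a → trans (∑-cong xs (λ b → ∑-*ˡ xs k (F a b))) (∑-*ˡ xs k _)))
                    (∑-*ˡ xs k _)

  ∑³-swap₁₂ : ∀ F → ∑³ (λ a b c → F b a c) ≡ ∑³ F
  ∑³-swap₁₂ F = ∑-comm xs xs (λ a b → ∑[ c ∈ xs ] F b a c)

  ∑³-swap₂₃ : ∀ F → ∑³ (λ a b c → F a c b) ≡ ∑³ F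
  ∑³-swap₂₃ F = ∑-cong xs (λ a → ∑-comm xs xs (λ b c → F a c b))

  ∑³-symmetrise : ∀ F → ∑³ (symmetrise F) ≡ 6 *ₙ ∑³ F
  ∑³-symmetrise F = begin
    ∑³ (symmetrise F)
      ≡⟨ trans (∑³-+ _ _) (cong (_+ₙ ∑³ (λ a b c → F c a b +ₙ F c b a)) (∑³-+ _ _)) ⟩
    ∑³ (λ a b c → F a b c +ₙ F a c b) +ₙ ∑³ (λ a b c → F b a c +ₙ F b c a)
      +ₙ ∑³ (λ a b c → F c a b +ₙ F c b a)
      ≡⟨ cong₂ _+ₙ_ (cong₂ _+ₙ_ (twice refl (∑³-swap₂₃ F)) (twice (∑³-swap₁₂ F) F-bca))
                    (twice F-cab (trans (∑³-swap₁₂ (λ a b c → F c a b)) F-cab)) ⟩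
    (∑³ F +ₙ ∑³ F) +ₙ (∑³ F +ₙ ∑³ F) +ₙ (∑³ F +ₙ ∑³ F)
      ≡⟨ solve 1 (λ x → (x :+ x) :+ (x :+ x) :+ (x :+ x) := con 6 :* x) refl (∑³ F) ⟩
    6 *ₙ ∑³ F ∎
    where
    open ≡-Reasoning
    open ℕ-Solver
    twice : ∀ {G H} → ∑³ G ≡ ∑³ F → ∑³ H ≡ ∑³ F → ∑³ (λ a b c → G a b c +ₙ H a b c) ≡ ∑³ F +ₙ ∑³ F
    twice {G} {H} g h = trans (∑³-+ G H) (cong₂ _+ₙ_ g h)
    F-bca : ∑³ (λ a b c → F b c a) ≡ ∑³ F
    F-bca = trans (∑³-swap₁₂ (λ a b c → F a c b)) (∑³-swap₂₃ F)
    F-cab : ∑³ (λ a b c → F c a b) ≡ ∑³ F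
    F-cab = trans (∑³-swap₂₃ (λ a b c → F b a c)) (∑³-swap₁₂ F)

module Instance {n : ℕ} (s : Signs n) (s-sym : ∀ u v → s u v ≡ s v u) (opt : Clustering n) where

  err : Fin n → Fin n → Bool
  err = mistake s opt

  same : Fin n → Fin n → Bool
  same = sameCluster opt

  err-sym : ∀ u v → err u v ≡ err v u
  err-sym u v rewrite s-sym u v | eqᵇ-sym (opt u) (opt v) = refl

  err-plus : ∀ {u v} → s u v ≡ true → err u v ≡ not (same u v)
  err-plus uv rewrite uv = refl

  err-minus : ∀ {u v} → s u v ≡ false → err u v ≡ same u v
  err-minus uv rewrite uv = refl

  same-sym : ∀ u v → same u v ≡ same v u
  same-sym u v = eqᵇ-sym (opt u) (opt v)

  same-trans : ∀ {u v w} → same u v ≡ true → same v w ≡ true → same u w ≡ true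
  same-trans = eqᵇ-trans

  correct : Fin n → Fin n → Fin n → ℕ
  correct u v w = correctQueries (s u v) (s u w) (err u v) (err u w)

  charged : Fin n → Fin n → Fin n → ℕ
  charged u v w = 𝟙 (err v w ∧ not (err u v) ∧ not (err u w))

  apexBound-at : ∀ a b c → s a b ≡ true → s a c ≡ true → s b c ≡ false →
                 pivotSum correct a b c ≤ₙ 4 *ₙ pivotSum charged a b c
  apexBound-at a b c ab ac bc
    rewrite s-sym b a | s-sym c a | s-sym c b | ab | ac | bc
          | eqᵇ-sym (opt b) (opt a) | eqᵇ-sym (opt c) (opt a) | eqᵇ-sym (opt c) (opt b)
    = apexBound (same a b) (same a c) (same b c)
                (λ a~b a~c → same-trans (trans (same-sym b a) a~b) a~c)
                same-trans
                (λ a~c b~c → same-trans a~c (trans (same-sym c b) b~c))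

  correct-sym : ∀ u v w → correct u v w ≡ correct u w v
  correct-sym u v w = correctQueries-comm (s u v) (s u w) (err u v) (err u w)

  charged-sym : ∀ u v w → charged u v w ≡ charged u w v
  charged-sym u v w rewrite err-sym v w = cong (λ b → 𝟙 (err w v ∧ b)) (∧-comm (not (err u v)) _)

  triangleBound : ∀ a b c → isPlusPlusMinus (s a b) (s a c) (s b c) ≡ true →
                  pivotSum correct a b c ≤ₙ 4 *ₙ pivotSum charged a b c
  triangleBound a b c ppm with isPlusPlusMinus-cases (s a b) (s a c) (s b c) ppm
  ... | inj₁ (ab , ac , bc) = apexBound-at a b c ab ac bc
  ... | inj₂ (inj₁ (ab , ac , bc)) =
    subst₂ (λ x y → x ≤ₙ 4 *ₙ y) (pivotSum-swap correct-sym a b c) (pivotSum-swap charged-sym a b c)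
           (apexBound-at b a c (trans (s-sym b a) ab) bc ac)
  ... | inj₂ (inj₂ (ab , ac , bc)) =
    subst₂ (λ x y → x ≤ₙ 4 *ₙ y) (pivotSum-rotate correct-sym a b c) (pivotSum-rotate charged-sym a b c)
           (apexBound-at c a b (trans (s-sym c a) ac) (trans (s-sym c b) bc) ab)

  triangleAt : Fin n → Fin n → Fin n → Bool
  triangleAt u i j = not (eqᵇ i u) ∧ not (eqᵇ j u) ∧ isPlusPlusMinus (s u i) (s u j) (s i j)

  triangleAt-sym : ∀ u i j → triangleAt u j i ≡ triangleAt u i j
  triangleAt-sym u i j
    rewrite s-sym j i | isPlusPlusMinus-swap₁₂ (s u i) (s u j) (s i j) with eqᵇ i u | eqᵇ j u
  ... | true  | true  = refl
  ... | true  | false = refl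
  ... | false | true  = refl
  ... | false | false = refl

  onTriangle : (Fin n → Fin n → Fin n → ℕ) → Fin n → Fin n → Fin n → ℕ
  onTriangle h u i j = 𝟙 (lt i j) *ₙ (𝟙 (triangleAt u i j) *ₙ h u i j)

  distinctTriangle : Fin n → Fin n → Fin n → Bool
  distinctTriangle a b c =
    not (eqᵇ b a) ∧ not (eqᵇ c a) ∧ not (eqᵇ c b) ∧ isPlusPlusMinus (s a b) (s a c) (s b c)

  module _ {h : Fin n → Fin n → Fin n → ℕ} (h-sym : ∀ u v w → h u v w ≡ h u w v) where

    onTriangle-pair : ∀ u i j → onTriangle h u i j +ₙ onTriangle h u j i
                                ≡ 𝟙 (not (eqᵇ j i)) *ₙ (𝟙 (triangleAt u i j) *ₙ h u i j)
    onTriangle-pair u i j rewrite triangleAt-sym u i j | h-sym u j i = 𝟙-lt-pair i j _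

    symmetrise-onTriangle : ∀ a b c →
      symmetrise (onTriangle h) a b c ≡ 𝟙 (distinctTriangle a b c) *ₙ pivotSum h a b c
    symmetrise-onTriangle a b c
      rewrite onTriangle-pair a b c | onTriangle-pair b a c | onTriangle-pair c a b
            | eqᵇ-sym a b | eqᵇ-sym a c | eqᵇ-sym b c | s-sym b a | s-sym c a | s-sym c b
            | isPlusPlusMinus-swap₂₃ (s a b) (s b c) (s a c) | isPlusPlusMinus-rotate (s a b) (s a c) (s b c)
      with eqᵇ b a | eqᵇ c a | eqᵇ c b
    ... | false | false | false =
      solve 4 (λ p x y z → con 1 :* (p :* x) :+ con 1 :* (p :* y) :+ con 1 :* (p :* z)
                        := p :* (x :+ y :+ z))
            refl (𝟙 (isPlusPlusMinus (s a b) (s a c) (s b c))) (h a b c) (h b a c) (h c a b)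
      where open ℕ-Solver
    ... | false | false | true  = refl
    ... | false | true  | false = refl
    ... | false | true  | true  = refl
    ... | true  | false | false = refl
    ... | true  | false | true  = refl
    ... | true  | true  | false = refl
    ... | true  | true  | true  = refl

  -- Summing over the orderings of each triple brings the three pivots of a triangle together.
  ∑³-correct≤4∑³-charged : ∀ V → ∑³ V (onTriangle correct) ≤ₙ 4 *ₙ ∑³ V (onTriangle charged)
  ∑³-correct≤4∑³-charged V = ℕ.*-cancelˡ-≤ 6 (begin
    6 *ₙ ∑³ V (onTriangle correct)
      ≡⟨ ∑³-symmetrise V (onTriangle correct) ⟨
    ∑³ V (symmetrise (onTriangle correct))
      ≤⟨ ∑³-mono V symmetrise-bound ⟩
    ∑³ V (λ a b c → 4 *ₙ symmetrise (onTriangle charged) a b c)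
      ≡⟨ ∑³-*ˡ V 4 (symmetrise (onTriangle charged)) ⟩
    4 *ₙ ∑³ V (symmetrise (onTriangle charged))
      ≡⟨ cong (4 *ₙ_) (∑³-symmetrise V (onTriangle charged)) ⟩
    4 *ₙ (6 *ₙ ∑³ V (onTriangle charged))
      ≡⟨ solve 1 (λ x → con 4 :* (con 6 :* x) := con 6 :* (con 4 :* x)) refl (∑³ V (onTriangle charged)) ⟩
    6 *ₙ (4 *ₙ ∑³ V (onTriangle charged)) ∎)
    where
    open ℕ.≤-Reasoning
    open ℕ-Solver using (solve; _:*_; _:=_; con)
    symmetrise-bound : ∀ a b c →
      symmetrise (onTriangle correct) a b c ≤ₙ 4 *ₙ symmetrise (onTriangle charged) a b c
    symmetrise-bound a b c
      rewrite symmetrise-onTriangle correct-sym a b c | symmetrise-onTriangle charged-sym a b c =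
      𝟙-*-≤ (distinctTriangle a b c) 4 (λ d → triangleBound a b c
        (∧-trueʳ (not (eqᵇ c b)) (∧-trueʳ (not (eqᵇ c a)) (∧-trueʳ (not (eqᵇ b a)) d))))

  costOf : List (Fin n) → ℕ
  costOf W = countᵇ (λ e → err (proj₁ e) (proj₂ e)) (pairsOf W)

  mistakeAt : Fin n → Fin n → ℕ
  mistakeAt i j = 𝟙 (lt i j) *ₙ 𝟙 (err i j)

  costOf≡∑ : ∀ W → costOf W ≡ ∑² W mistakeAt
  costOf≡∑ W = trans (countᵇ≡∑ _ (pairsOf W)) (∑-pairsOf W _)

  mistakeAt-pair : ∀ u x → mistakeAt u x +ₙ mistakeAt x u ≡ 𝟙 (not (eqᵇ x u)) *ₙ 𝟙 (err u x)
  mistakeAt-pair u x rewrite err-sym x u = 𝟙-lt-pair u x (𝟙 (err u x))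

  -- One round with a fixed pivot

  module Pivot (V : List (Fin n)) (u : Fin n) where

    open Round s opt V u hiding (err)

    correctCount : Fin n × Fin n → ℕ
    correctCount (v , w) = ∑ (triangleQueries v w) (λ e → 𝟙 (not (proj₂ e)))

    plusFirst : Fin n → Fin n → Bool → Bool → List (Fin n × Bool)
    plusFirst v w mv mw = if mv then (v , true) ∷ [] else (v , false) ∷ (w , mw) ∷ []

    plusFirst-correct : ∀ v w ev ew →
      ∑ (plusFirst v w ev ew) (λ e → 𝟙 (not (proj₂ e))) ≡ correctQueries true false ev ew
    plusFirst-correct v w true  ew = refl
    plusFirst-correct v w false ew = cong suc (ℕ.+-identityʳ _)

    correctCount≡correct : ∀ v w → correctCount (v , w) ≡ correct u v w
    correctCount≡correct v w with s u v in uv | s u w in uw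
    ... | true  | true  =
      trans (cong (𝟙 (not (err u v)) +ₙ_) (ℕ.+-identityʳ _))
            (cong₂ (λ a b → 𝟙 (not a) +ₙ 𝟙 (not b)) (err-plus {u} {v} uv) (err-plus {u} {w} uw))
    ... | true  | false =
      trans (plusFirst-correct v w (err u v) (err u w))
            (cong₂ (correctQueries true false) (err-plus {u} {v} uv) (err-minus {u} {w} uw))
    ... | false | true  =
      trans (plusFirst-correct w v (err u w) (err u v))
            (trans (cong₂ (correctQueries true false) (err-plus {u} {w} uw) (err-minus {u} {v} uv))
                   (correctQueries-comm true false (not (same u w)) (same u v)))
    ... | false | false = refl

    Honest : Fin n × Bool → Set
    Honest (x , mark) = mark ≡ err u x

    plusFirst-honest : ∀ v w mv → mv ≡ err u v → All Honest (plusFirst v w mv (err u w))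
    plusFirst-honest v w true  h = h ∷ []
    plusFirst-honest v w false h = h ∷ refl ∷ []

    triangleQueries-honest : ∀ v w → All Honest (triangleQueries v w)
    triangleQueries-honest v w with s u v | s u w
    ... | true  | true  = refl ∷ refl ∷ []
    ... | true  | false = plusFirst-honest v w (err u v) refl
    ... | false | true  = plusFirst-honest w v (err u w) refl
    ... | false | false = []

    events-honest : ∀ ts cs → All Honest (events ts cs)
    events-honest []            _           = []
    events-honest (_ ∷ _)       []          = []
    events-honest ((v , w) ∷ ts) (true ∷ cs)  = All.++⁺ (triangleQueries-honest v w) (events-honest ts cs)
    events-honest ((v , w) ∷ ts) (false ∷ cs) = events-honest ts cs

    ∑-events : ∀ ts cs (g : Fin n × Bool → ℕ) →
               ∑ (events ts cs) g ≡ selectedTotal (λ t → ∑ (triangleQueries (proj₁ t) (proj₂ t)) g) ts cs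
    ∑-events []            _           g = refl
    ∑-events (_ ∷ _)       []          g = refl
    ∑-events ((v , w) ∷ ts) (true ∷ cs)  g =
      trans (∑-++ (triangleQueries v w) (events ts cs) g) (cong (_ +ₙ_) (∑-events ts cs g))
    ∑-events ((v , w) ∷ ts) (false ∷ cs) g = ∑-events ts cs g

    marked⇒err : ∀ cs x → marked cs x ≡ true → err u x ≡ true
    marked⇒err cs x = go (events-honest triangles cs)
      where
      go : ∀ {es} → All Honest es → any (λ e → eqᵇ (proj₁ e) x ∧ proj₂ e) es ≡ true → err u x ≡ true
      go {(y , mark) ∷ _} (honest ∷ rest) found with eqᵇ y x in y≡x | mark
      ... | true  | true  rewrite eqᵇ⇒≡ y≡x = sym honest
      ... | true  | false = go rest found
      ... | false | _     = go rest found

    inC-unerring : ∀ cs x → err u x ≡ false → inC cs x ≡ s u x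
    inC-unerring cs x e with marked cs x in m
    ... | true with () ← trans (sym (marked⇒err cs x m)) e
    ... | false with s u x
    ...   | true  = refl
    ...   | false = refl

    incident : ℕ
    incident = ∑[ x ∈ others ] 𝟙 (err u x)

    numQueries≤ : Unique V → ∀ cs → numQueries cs ≤ₙ incident +ₙ selectedTotal correctCount triangles cs
    numQueries≤ uniqueV cs = begin
      numQueries cs
        ≡⟨ countᵇ≡∑ (queried cs) others ⟩
      ∑[ x ∈ others ] 𝟙 (queried cs x)
        ≤⟨ ∑-mono others queried≤ ⟩
      ∑[ x ∈ others ] (𝟙 (err u x) +ₙ ∑[ e ∈ es ] (𝟙 (eqᵇ (proj₁ e) x) *ₙ 𝟙 (not (err u x))))
        ≡⟨ ∑-+ others _ _ ⟩
      incident +ₙ ∑[ x ∈ others ] ∑[ e ∈ es ] (𝟙 (eqᵇ (proj₁ e) x) *ₙ 𝟙 (not (err u x)))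
        ≡⟨ cong (incident +ₙ_) (∑-comm others es _) ⟩
      incident +ₙ ∑[ e ∈ es ] ∑[ x ∈ others ] (𝟙 (eqᵇ (proj₁ e) x) *ₙ 𝟙 (not (err u x)))
        ≤⟨ ℕ.+-monoʳ-≤ incident (∑-mono es (λ e →
             ∑-indicator-unique (Unique.filter⁺ _ uniqueV) (proj₁ e) (λ x → 𝟙 (not (err u x))))) ⟩
      incident +ₙ ∑[ e ∈ es ] 𝟙 (not (err u (proj₁ e)))
        ≡⟨ cong (incident +ₙ_) (∑-cong-All (events-honest triangles cs) (λ _ honest → cong (𝟙 ∘ not) (sym honest))) ⟩
      incident +ₙ ∑[ e ∈ es ] 𝟙 (not (proj₂ e))
        ≡⟨ cong (incident +ₙ_) (∑-events triangles cs _) ⟩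
      incident +ₙ selectedTotal correctCount triangles cs ∎
      where
      open ℕ.≤-Reasoning
      es : List (Fin n × Bool)
      es = events triangles cs
      queried≤ : ∀ x → 𝟙 (queried cs x) ≤ₙ 𝟙 (err u x) +ₙ ∑[ e ∈ es ] (𝟙 (eqᵇ (proj₁ e) x) *ₙ 𝟙 (not (err u x)))
      queried≤ x with err u x
      ... | true  = ℕ.≤-trans (𝟙≤1 _) (ℕ.m≤m+n 1 _)
      ... | false = ℕ.≤-trans (𝟙-any≤∑ _ es) (ℕ.≤-reflexive (∑-cong es (λ e → sym (ℕ.*-identityʳ _))))

    ∑-others : ∀ f → ∑ others f ≡ ∑[ x ∈ V ] (𝟙 (not (eqᵇ x u)) *ₙ f x)
    ∑-others f = trans (∑-filter _ V f)
                       (∑-cong V (λ x → cong (λ b → 𝟙 (not b) *ₙ f x) (sym (isYes≗does (x Fin.≟ u)))))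

    kept : List Bool → Fin n → Bool
    kept cs x = not (eqᵇ x u) ∧ not (inC cs x)

    ∑-rest : ∀ cs f → ∑ (rest cs) f ≡ ∑[ x ∈ V ] (𝟙 (kept cs x) *ₙ f x)
    ∑-rest cs f = begin
      ∑ (rest cs) f
        ≡⟨ ∑-filter _ others f ⟩
      ∑[ x ∈ others ] (𝟙 (not (does (inC cs x Bool.≟ true))) *ₙ f x)
        ≡⟨ ∑-others _ ⟩
      ∑[ x ∈ V ] (𝟙 (not (eqᵇ x u)) *ₙ (𝟙 (not (does (inC cs x Bool.≟ true))) *ₙ f x))
        ≡⟨ ∑-cong V (λ x → cong (λ b → 𝟙 (not (eqᵇ x u)) *ₙ (𝟙 (not b) *ₙ f x)) (does-≟true (inC cs x))) ⟩
      ∑[ x ∈ V ] (𝟙 (not (eqᵇ x u)) *ₙ (𝟙 (not (inC cs x)) *ₙ f x))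
        ≡⟨ ∑-cong V (λ x → sym (𝟙-∧-* (not (eqᵇ x u)) (not (inC cs x)) (f x))) ⟩
      ∑[ x ∈ V ] (𝟙 (kept cs x) *ₙ f x) ∎
      where
      open ≡-Reasoning
      does-≟true : ∀ b → does (b Bool.≟ true) ≡ b
      does-≟true true  = refl
      does-≟true false = refl

    ∑-triangles : ∀ g → ∑ triangles g ≡ ∑² V (onTriangle (λ _ i j → g (i , j)) u)
    ∑-triangles g = begin
      ∑ triangles g
        ≡⟨ ∑-filter _ (pairsOf others) g ⟩
      ∑[ e ∈ pairsOf others ] (𝟙 (ppm e) *ₙ g e)
        ≡⟨ ∑-pairsOf others _ ⟩
      ∑² others (λ i j → 𝟙 (lt i j) *ₙ (𝟙 (ppm (i , j)) *ₙ g (i , j)))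
        ≡⟨ ∑-others _ ⟩
      ∑[ i ∈ V ] (𝟙 (not (eqᵇ i u)) *ₙ ∑[ j ∈ others ] (𝟙 (lt i j) *ₙ (𝟙 (ppm (i , j)) *ₙ g (i , j))))
        ≡⟨ ∑-cong V (λ i → cong (𝟙 (not (eqᵇ i u)) *ₙ_) (∑-others _)) ⟩
      ∑[ i ∈ V ] (𝟙 (not (eqᵇ i u)) *ₙ ∑ V (summand i))
        ≡⟨ ∑-cong V (λ i → trans (sym (∑-*ˡ V (𝟙 (not (eqᵇ i u))) (summand i))) (∑-cong V (reorder i))) ⟩
      ∑² V (onTriangle (λ _ i j → g (i , j)) u) ∎
      where
      open ≡-Reasoning
      ppm : Fin n × Fin n → Bool
      ppm (i , j) = isPlusPlusMinus (s u i) (s u j) (s i j)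
      summand : Fin n → Fin n → ℕ
      summand i j = 𝟙 (not (eqᵇ j u)) *ₙ (𝟙 (lt i j) *ₙ (𝟙 (ppm (i , j)) *ₙ g (i , j)))
      reorder : ∀ i j → 𝟙 (not (eqᵇ i u)) *ₙ summand i j ≡ onTriangle (λ _ i j → g (i , j)) u i j
      reorder i j rewrite 𝟙-∧-* (not (eqᵇ i u)) (not (eqᵇ j u) ∧ ppm (i , j)) (g (i , j))
                        | 𝟙-∧-* (not (eqᵇ j u)) (ppm (i , j)) (g (i , j)) =
        solve 5 (λ a b l p x → a :* (b :* (l :* (p :* x))) := l :* (a :* (b :* (p :* x))))
              refl (𝟙 (not (eqᵇ i u))) (𝟙 (not (eqᵇ j u))) (𝟙 (lt i j)) (𝟙 (ppm (i , j))) (g (i , j))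
        where open ℕ-Solver using (solve; _:*_; _:=_)

    mistakeInRest : List Bool → Fin n → Fin n → ℕ
    mistakeInRest cs i j = 𝟙 (kept cs i) *ₙ (𝟙 (kept cs j) *ₙ mistakeAt i j)

    mistakeAtPivot : Fin n → Fin n → ℕ
    mistakeAtPivot i j = 𝟙 (eqᵇ i u) *ₙ mistakeAt i j +ₙ 𝟙 (eqᵇ j u) *ₙ mistakeAt i j

    costOf-rest : ∀ cs → costOf (rest cs) ≡ ∑² V (mistakeInRest cs)
    costOf-rest cs =
      trans (costOf≡∑ (rest cs)) (trans (∑-rest cs _) (∑-cong V (λ i →
        trans (cong (𝟙 (kept cs i) *ₙ_) (∑-rest cs _))
              (sym (∑-*ˡ V (𝟙 (kept cs i)) (λ j → 𝟙 (kept cs j) *ₙ mistakeAt i j))))))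

    incident≤ : u ∈ V → incident ≤ₙ ∑² V mistakeAtPivot
    incident≤ u∈V = begin
      incident
        ≡⟨ ∑-others _ ⟩
      ∑[ x ∈ V ] (𝟙 (not (eqᵇ x u)) *ₙ 𝟙 (err u x))
        ≡⟨ ∑-cong V (λ x → sym (mistakeAt-pair u x)) ⟩
      ∑[ x ∈ V ] (mistakeAt u x +ₙ mistakeAt x u)
        ≡⟨ ∑-+ V _ _ ⟩
      ∑[ j ∈ V ] mistakeAt u j +ₙ ∑[ i ∈ V ] mistakeAt i u
        ≤⟨ ℕ.+-mono-≤ (∑-indicator-∈ u∈V (λ i → ∑[ j ∈ V ] mistakeAt i j))
                      (∑-indicator-∈ u∈V (λ j → ∑[ i ∈ V ] mistakeAt i j)) ⟩
      ∑[ i ∈ V ] (𝟙 (eqᵇ i u) *ₙ ∑ V (mistakeAt i))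
        +ₙ ∑[ j ∈ V ] (𝟙 (eqᵇ j u) *ₙ ∑[ i ∈ V ] mistakeAt i j)
        ≡⟨ cong₂ _+ₙ_ (∑-cong V (λ i → sym (∑-*ˡ V (𝟙 (eqᵇ i u)) (mistakeAt i))))
                      (trans (∑-cong V (λ j → sym (∑-*ˡ V (𝟙 (eqᵇ j u)) (λ i → mistakeAt i j))))
                             (∑-comm V V _)) ⟩
      ∑² V (λ i j → 𝟙 (eqᵇ i u) *ₙ mistakeAt i j) +ₙ ∑² V (λ i j → 𝟙 (eqᵇ j u) *ₙ mistakeAt i j)
        ≡⟨ ∑²-+ V _ _ ⟨
      ∑² V mistakeAtPivot ∎
      where open ℕ.≤-Reasoning

    destroyed : ℕ
    destroyed = ∑ triangles (λ t → charged u (proj₁ t) (proj₂ t))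

    unerring : Fin n → Fin n → Bool
    unerring i j = not (err u i) ∧ not (err u j)

    notInC⇒minus : ∀ cs x → not (inC cs x) ≡ true → not (err u x) ≡ true → s u x ≡ false
    notInC⇒minus cs x x∉C x-correct = trans (sym (inC-unerring cs x (not-true x-correct))) (not-true x∉C)

    keptTriangle-absurd : ∀ cs i j → not (inC cs i) ∧ not (inC cs j) ≡ true →
                          isPlusPlusMinus (s u i) (s u j) (s i j) ∧ unerring i j ≡ true → ⊥
    keptTriangle-absurd cs i j k t = impossible (subst₂ (λ a b → a ∨ b ≡ true) i-minus j-minus someSignPlus)
      where
      correctAtU : unerring i j ≡ true
      correctAtU = ∧-trueʳ (isPlusPlusMinus (s u i) (s u j) (s i j)) t
      someSignPlus : s u i ∨ s u j ≡ true
      someSignPlus = isPlusPlusMinus⇒∨ (s u i) (s u j) (s i j) (∧-trueˡ _ t)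
      i-minus : s u i ≡ false
      i-minus = notInC⇒minus cs i (∧-trueˡ (not (inC cs i)) k) (∧-trueˡ (not (err u i)) correctAtU)
      j-minus : s u j ≡ false
      j-minus = notInC⇒minus cs j (∧-trueʳ (not (inC cs i)) k) (∧-trueʳ (not (err u i)) correctAtU)
      impossible : false ∨ false ≡ true → ⊥
      impossible ()

    -- A mistake ij lies at u, or survives into the rest, or is destroyed, never two of these:
    -- when OPT is right on ui and uj, both i and j join C exactly if their edge to u is +.
    fates-exclusive : ∀ cs i j → lt i j ≡ true →
      𝟙 (eqᵇ i u) +ₙ 𝟙 (eqᵇ j u) +ₙ 𝟙 (kept cs i ∧ kept cs j) +ₙ 𝟙 (triangleAt u i j ∧ unerring i j) ≤ₙ 1
    fates-exclusive cs i j i<j with eqᵇ i u in i≡u | eqᵇ j u in j≡u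
    ... | true  | true
      with () ← trans (sym (lt-irrefl u)) (subst₂ (λ a b → lt a b ≡ true) (eqᵇ⇒≡ i≡u) (eqᵇ⇒≡ j≡u) i<j)
    ... | true  | false = ℕ.≤-refl
    ... | false | true  rewrite ∧-zeroʳ (not (inC cs i)) = ℕ.≤-refl
    ... | false | false = 𝟙-exclusive _ _ (keptTriangle-absurd cs i j)

    mistakeAt-*≤ : ∀ i j {z} → (lt i j ≡ true → z ≤ₙ 1) → mistakeAt i j *ₙ z ≤ₙ mistakeAt i j
    mistakeAt-*≤ i j {z} z≤1 with lt i j in i<j
    ... | false = z≤n
    ... | true  = ℕ.≤-trans (ℕ.*-monoʳ-≤ (1 *ₙ 𝟙 (err i j)) (z≤1 refl)) (ℕ.≤-reflexive (ℕ.*-identityʳ _))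

    mistake-counted-once : ∀ cs i j →
      mistakeInRest cs i j +ₙ (mistakeAtPivot i j +ₙ onTriangle charged u i j) ≤ₙ mistakeAt i j
    mistake-counted-once cs i j = begin
      mistakeInRest cs i j +ₙ (mistakeAtPivot i j +ₙ onTriangle charged u i j)
        ≡⟨ cong₂ (λ a c → a +ₙ (mistakeAtPivot i j +ₙ 𝟙 (lt i j) *ₙ (𝟙 tA *ₙ c)))
                 (sym (𝟙-∧-* (kept cs i) (kept cs j) M)) (𝟙-∧ (err i j) (unerring i j)) ⟩
      𝟙 (kept cs i ∧ kept cs j) *ₙ M
        +ₙ (mistakeAtPivot i j +ₙ 𝟙 (lt i j) *ₙ (𝟙 tA *ₙ (𝟙 (err i j) *ₙ 𝟙 (unerring i j))))
        ≡⟨ solve 7 (λ l e iu ju k t w →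
                     k :* (l :* e) :+ ((iu :* (l :* e) :+ ju :* (l :* e)) :+ l :* (t :* (e :* w)))
                     := (l :* e) :* (iu :+ ju :+ k :+ t :* w))
                 refl (𝟙 (lt i j)) (𝟙 (err i j)) (𝟙 (eqᵇ i u)) (𝟙 (eqᵇ j u))
                      (𝟙 (kept cs i ∧ kept cs j)) (𝟙 tA) (𝟙 (unerring i j)) ⟩
      M *ₙ (𝟙 (eqᵇ i u) +ₙ 𝟙 (eqᵇ j u) +ₙ 𝟙 (kept cs i ∧ kept cs j) +ₙ 𝟙 tA *ₙ 𝟙 (unerring i j))
        ≡⟨ cong (λ z → M *ₙ (𝟙 (eqᵇ i u) +ₙ 𝟙 (eqᵇ j u) +ₙ 𝟙 (kept cs i ∧ kept cs j) +ₙ z))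
                (sym (𝟙-∧ tA (unerring i j))) ⟩
      M *ₙ (𝟙 (eqᵇ i u) +ₙ 𝟙 (eqᵇ j u) +ₙ 𝟙 (kept cs i ∧ kept cs j) +ₙ 𝟙 (tA ∧ unerring i j))
        ≤⟨ mistakeAt-*≤ i j (fates-exclusive cs i j) ⟩
      M ∎
      where
      open ℕ.≤-Reasoning
      open ℕ-Solver using (solve; _:*_; _:+_; _:=_)
      M : ℕ
      M = mistakeAt i j
      tA : Bool
      tA = triangleAt u i j

    costOf-split : u ∈ V → ∀ cs → costOf (rest cs) +ₙ (incident +ₙ destroyed) ≤ₙ costOf V
    costOf-split u∈V cs = begin
      costOf (rest cs) +ₙ (incident +ₙ destroyed)
        ≤⟨ ℕ.+-mono-≤ (ℕ.≤-reflexive (costOf-rest cs))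
                      (ℕ.+-mono-≤ (incident≤ u∈V) (ℕ.≤-reflexive (∑-triangles _))) ⟩
      ∑² V (mistakeInRest cs) +ₙ (∑² V mistakeAtPivot +ₙ ∑² V (onTriangle charged u))
        ≡⟨ trans (∑²-+ V (mistakeInRest cs) (λ i j → mistakeAtPivot i j +ₙ onTriangle charged u i j))
                 (cong (∑² V (mistakeInRest cs) +ₙ_) (∑²-+ V mistakeAtPivot (onTriangle charged u))) ⟨
      ∑² V (λ i j → mistakeInRest cs i j +ₙ (mistakeAtPivot i j +ₙ onTriangle charged u i j))
        ≤⟨ ∑-mono V (λ i → ∑-mono V (mistake-counted-once cs i)) ⟩
      ∑² V mistakeAt
        ≡⟨ costOf≡∑ V ⟨
      costOf V ∎
      where open ℕ.≤-Reasoning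

    rest-unique : Unique V → ∀ cs → Unique (rest cs)
    rest-unique uniqueV cs = Unique.filter⁺ _ (Unique.filter⁺ _ uniqueV)

    remaining : ℕ
    remaining = costOf V ∸ (incident +ₙ destroyed)

    charge-total : u ∈ V → incident +ₙ destroyed +ₙ remaining ≡ costOf V
    charge-total u∈V =
      trans (ℕ.+-comm (incident +ₙ destroyed) _)
            (ℕ.m∸n+n≡m (ℕ.≤-trans (ℕ.m≤n+m _ (costOf (rest []))) (costOf-split u∈V [])))

    ∑-correctCount : ∑ triangles correctCount ≡ ∑² V (onTriangle correct u)
    ∑-correctCount = trans (∑-triangles correctCount) (∑-cong V (λ i → ∑-cong V (λ j →
      cong (λ z → 𝟙 (lt i j) *ₙ (𝟙 (triangleAt u i j) *ₙ z)) (correctCount≡correct i j))))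

  -- Induction over the rounds

  module Analysis (p : ℚ) (0≤p : 0ℚ ≤ p) (p≤1 : p ≤ 1ℚ) where

    open Charging p 0≤p
    open Expectation p

    EQ : ℕ → List (Fin n) → ℚ
    EQ = expectedQueries s opt p

    module _ (f : ℕ) (V : List (Fin n)) (uniqueV : Unique V) (u : Fin n) (u∈V : u ∈ V) where

      open Round s opt V u hiding (err)
      open Pivot V u

      roundBound : (∀ cs → EQ f (rest cs) ≤ c * ℕ→ℚ (costOf (rest cs))) →
        expect p (length triangles) (λ cs → ℕ→ℚ (numQueries cs) + EQ f (rest cs))
          ≤ ℕ→ℚ incident + p * ℕ→ℚ (∑ triangles correctCount) + c * ℕ→ℚ remaining
      roundBound ih = begin
        expect p k (λ cs → ℕ→ℚ (numQueries cs) + EQ f (rest cs))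
          ≤⟨ expect-mono 0≤p p≤1 k (λ cs →
               ℚ.+-mono-≤ (queries cs) (ℚ.≤-trans (ih cs) (c*-mono (restCost cs)))) ⟩
        expect p k (λ cs → (ℕ→ℚ incident + selected cs) + c * ℕ→ℚ remaining)
          ≡⟨ expect-+ k (λ cs → ℕ→ℚ incident + selected cs) (λ _ → c * ℕ→ℚ remaining) ⟩
        expect p k (λ cs → ℕ→ℚ incident + selected cs) + expect p k (λ _ → c * ℕ→ℚ remaining)
          ≡⟨ cong₂ _+_ (expect-+ k (λ _ → ℕ→ℚ incident) selected) (expect-const k (c * ℕ→ℚ remaining)) ⟩
        expect p k (λ _ → ℕ→ℚ incident) + expect p k selected + c * ℕ→ℚ remaining
          ≡⟨ cong₂ (λ x y → x + y + c * ℕ→ℚ remaining) (expect-const k (ℕ→ℚ incident))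
                   (expect-selectedTotal correctCount triangles) ⟩
        ℕ→ℚ incident + p * ℕ→ℚ (∑ triangles correctCount) + c * ℕ→ℚ remaining ∎
        where
        open ℚ.≤-Reasoning
        k : ℕ
        k = length triangles
        selected : List Bool → ℚ
        selected cs = ℕ→ℚ (selectedTotal correctCount triangles cs)
        queries : ∀ cs → ℕ→ℚ (numQueries cs) ≤ ℕ→ℚ incident + selected cs
        queries cs = ℚ.≤-trans (ℕ→ℚ-mono (numQueries≤ uniqueV cs))
                               (ℚ.≤-reflexive (ℕ→ℚ-+ incident (selectedTotal correctCount triangles cs)))
        restCost : ∀ cs → costOf (rest cs) ≤ₙ remaining
        restCost cs = ℕ.m+n≤o⇒m≤o∸n (costOf (rest cs)) (costOf-split u∈V cs)

    expectedQueries≤c*costOf : ∀ f V → Unique V → EQ f V ≤ c * ℕ→ℚ (costOf V)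
    expectedQueries≤c*costOf zero    V        _       = 0≤c*ℕ→ℚ (costOf V)
    expectedQueries≤c*costOf (suc f) []       _       = 0≤c*ℕ→ℚ 0
    expectedQueries≤c*costOf (suc f) V@(_ ∷ vs) uniqueV =
      ℚ.≤-trans (ℚ.*-monoˡ-≤-nonNeg (+ 1 / length V) {{ℚ.normalize-nonNeg 1 (length V)}} rounds)
                (average≤ (length vs) (∑ V incidentAt) (∑ V correctAt) (∑ V remainingAt) (costOf V)
                          correct≤4destroyed total)
      where
      incidentAt correctAt destroyedAt remainingAt : Fin n → ℕ
      incidentAt u = Pivot.incident V u
      correctAt u = ∑ (Round.triangles s opt V u) (Pivot.correctCount V u)
      destroyedAt u = Pivot.destroyed V u
      remainingAt u = Pivot.remaining V u

      rounds : sumℚ (map (λ u → expect p (length (Round.triangles s opt V u))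
                                   (λ cs → ℕ→ℚ (Round.numQueries s opt V u cs) + EQ f (Round.rest s opt V u cs))) V)
               ≤ ℕ→ℚ (∑ V incidentAt) + p * ℕ→ℚ (∑ V correctAt) + c * ℕ→ℚ (∑ V remainingAt)
      rounds = ℚ.≤-trans
        (sumℚ-mono-∈ V {g = λ u → ℕ→ℚ (incidentAt u) + p * ℕ→ℚ (correctAt u) + c * ℕ→ℚ (remainingAt u)}
                       (λ u u∈V → roundBound f V uniqueV u u∈V (λ cs →
          expectedQueries≤c*costOf f (Round.rest s opt V u cs) (Pivot.rest-unique V u uniqueV cs))))
        (ℚ.≤-reflexive (sumℚ-linear V p c incidentAt correctAt remainingAt))

      correct≤4destroyed : ∑ V correctAt ≤ₙ 4 *ₙ ∑ V destroyedAt
      correct≤4destroyed =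
        subst₂ (λ a b → a ≤ₙ 4 *ₙ b)
               (sym (∑-cong V (Pivot.∑-correctCount V))) (sym (∑-cong V (λ u → Pivot.∑-triangles V u _)))
               (∑³-correct≤4∑³-charged V)

      total : ∑ V incidentAt +ₙ ∑ V destroyedAt +ₙ ∑ V remainingAt ≡ suc (length vs) *ₙ costOf V
      total = begin
        ∑ V incidentAt +ₙ ∑ V destroyedAt +ₙ ∑ V remainingAt
          ≡⟨ cong (_+ₙ ∑ V remainingAt) (∑-+ V incidentAt destroyedAt) ⟨
        ∑ V (λ u → incidentAt u +ₙ destroyedAt u) +ₙ ∑ V remainingAt
          ≡⟨ ∑-+ V _ remainingAt ⟨
        ∑[ u ∈ V ] (incidentAt u +ₙ destroyedAt u +ₙ remainingAt u)
          ≡⟨ ∑-cong-∈ V (λ u u∈V → Pivot.charge-total V u u∈V) ⟩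
        ∑[ u ∈ V ] costOf V
          ≡⟨ ∑-const V (costOf V) ⟩
        suc (length vs) *ₙ costOf V ∎
        where open ≡-Reasoning

lemma9 : (n : ℕ) (s : Signs n) → (∀ u v → s u v ≡ s v u) →
         (opt : Clustering n) → Optimal s opt →
         (p : ℚ) → 0ℚ ≤ p → p ≤ 1ℚ →
         expectedQueries s opt p n (allFin n)
           ≤ (((ℕ→ℚ 4) * p) ⊔ 1ℚ) * ℕ→ℚ (cost s opt)
lemma9 n s s-sym opt _ p 0≤p p≤1 =
  Instance.Analysis.expectedQueries≤c*costOf s s-sym opt p 0≤p p≤1 n (allFin n) (Unique.allFin⁺ n)
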